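{- Let $\alpha,\beta\in S_n$ with $H(\alpha\beta,\beta\alpha)=k>0$. Suppose that $\alpha$ does not commute with $\beta$ on the cycles $\beta_1,\dots,\beta_r$ of $\beta$, of lengths $l_1,\dots,l_r$, and commutes with $\beta$ on all other cycles of $\beta$ (if any). Then there exist exactly $r$ cycles $\beta_1',\dots,\beta_r'$ of $\beta$, of lengths $l_1,\dots,l_r$ respectively, such that $\alpha(\mathrm{set}(\beta_1)\cup\dots\cup\mathrm{set}(\beta_r))=\mathrm{set}(\beta_1')\cup\dots\cup\mathrm{set}(\beta_r')$. Moreover, if $\alpha$ does not commute with $\beta$ on exactly $h_i$ of the $i$-cycles of $\beta$ and commutes with $\beta$ on the remaining $i$-cycles (if any), then exactly $h_i$ of the $i$-cycles of $\beta$ contain at least one point that is the image under $\alpha$ of a bad commuting point of $\alpha$ and $\beta$.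
   Context: $S_n$ is the symmetric group on $[n]$, products composed right to left; $H(\sigma,\tau)=|\{a:\sigma(a)\ne\tau(a)\}|$. Cycles of $\beta$ include fixed points as $1$-cycles; $\mathrm{set}(\beta_j)$ is the set of points of the cycle $\beta_j$. A point $a$ is a bad commuting point of $\alpha,\beta$ if $\alpha\beta(a)\ne\beta\alpha(a)$. $\alpha$ commutes with $\beta$ on a cycle $\beta_j$ if no point of $\beta_j$ is a bad commuting point, and does not commute with $\beta$ on $\beta_j$ otherwise. -}

module Defs where

open import Data.Nat using (ℕ; zero; suc)
open import Data.Fin using (Fin; _≟_)
open import Data.Fin.Permutation using (Permutation′; _⟨$⟩ʳ_)
open import Data.Fin.Subset using (Subset; _∈_; ∣_∣)
open import Data.List using (length; filter)
open import Data.List.Base using ()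
open import Data.Fin.Base using ()
open import Data.List using (List)
open import Data.Fin.Properties using ()
open import Data.Product using (Σ; ∃; _×_)
open import Relation.Binary.PropositionalEquality using (_≡_; _≢_)
open import Relation.Nullary using (¬_)
open import Relation.Nullary.Decidable using (¬?)
open import Function.Definitions using (Injective)
open import Function.Bundles using (_⇔_)
import Data.List.Base as L
open import Data.List using (allFin)

Perm : ℕ → Set
Perm n = Permutation′ n

_$_ : ∀ {n} → Perm n → Fin n → Fin n
π $ a = π ⟨$⟩ʳ a

_·_ : ∀ {n} → Perm n → Perm n → Fin n → Fin n
(σ · τ) a = σ $ (τ $ a)

H : ∀ {n} → (Fin n → Fin n) → (Fin n → Fin n) → ℕ
H {n} σ τ = length (filter (λ a → ¬? (σ a ≟ τ a)) (allFin n))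

iter : ∀ {n} → Perm n → ℕ → Fin n → Fin n
iter β zero a = a
iter β (suc m) a = β $ (iter β m a)

SameCycle : ∀ {n} → Perm n → Fin n → Fin n → Set
SameCycle β a b = ∃ λ m → iter β m a ≡ b

-- C is (the point set of) a cycle of β (fixed points give 1-cycles)
IsCycle : ∀ {n} → Perm n → Subset n → Set
IsCycle {n} β C = ∃ λ (a : Fin n) → ∀ b → (b ∈ C) ⇔ SameCycle β a b

Bad : ∀ {n} → Perm n → Perm n → Fin n → Set
Bad α β a = (α · β) a ≢ (β · α) a

CommutesOn : ∀ {n} → Perm n → Perm n → Subset n → Set
CommutesOn α β C = ∀ a → a ∈ C → ¬ Bad α β a

NumCycles : ∀ {n} → Perm n → (Subset n → Set) → ℕ → Set
NumCycles {n} β P h =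
  Σ (Fin h → Subset n) λ L →
    Injective _≡_ _≡_ L
    × (∀ j → IsCycle β (L j) × P (L j))
    × (∀ C → IsCycle β C → P C → ∃ λ j → L j ≡ C)

InUnion : ∀ {n r} → (Fin r → Subset n) → Fin n → Set
InUnion C b = ∃ λ j → b ∈ C j

-- Let U be the union of the cycles of β on which α does not commute with β. Then U is
-- β-invariant, every bad point lies in U, and α commutes with β off U. Sending a point
-- b ∈ α(U) forward along its α-orbit to the first point of U, and any other b to α⁻¹ b,
-- gives a permutation φ commuting with β with φ(α(U)) = U; so the cycles of β inside α(U)
-- are the preimages under φ of those inside U, with the same lengths. A cycle D contains
-- the image of a bad point iff D ⊆ α(U): for b ∈ D, α commutes with β along the β-orbit of
-- α⁻¹ b up to its first bad point, so α maps that bad point into D.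

module Submission where

open import Defs
open import Data.Bool.Base using (Bool; true; false)
open import Data.Bool.Properties using (T-≡)
open import Data.Empty using (⊥-elim)
open import Data.Fin.Base using (Fin; toℕ; fromℕ<; punchOut)
import Data.Fin.Properties as Finₚ
open import Data.Fin.Permutation using (_⟨$⟩ˡ_; inverseˡ; inverseʳ; permutation; flip)
open import Data.Fin.Subset using (Subset; _∈_; _⊆_; ∣_∣; inside)
open import Data.Fin.Subset.Properties using (_∈?_; ⊆-antisym; ⊆-reflexive)
open import Data.Nat.Base using (ℕ; zero; suc; _+_; _*_; _∸_; _≤_; _<_; z≤n; s≤s; s≤s⁻¹)
import Data.Nat.Properties as ℕ
open import Algebra.Properties.CommutativeMonoid.Sum ℕ.+-0-commutativeMonoid using (sum; sum-permute; sum-cong-≗)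
open import Data.Nat.DivMod using (_%_; _/_; m≡m%n+[m/n]*n; m%n<n)
open import Data.Product using (Σ; ∃; _×_; _,_; proj₁; proj₂)
open import Data.Sum using (_⊎_; inj₁; inj₂)
open import Data.Vec.Base using ([]; _∷_; tabulate; lookup)
open import Data.Vec.Properties using ([]=⇒lookup; lookup⇒[]=; lookup∘tabulate)
open import Function.Base using (_∘_)
open import Function.Bundles using (_⇔_; mk⇔; Equivalence)
open import Function.Definitions using (Injective)
import Function.Properties.Equivalence as ⇔
open import Relation.Binary.PropositionalEquality
open import Relation.Nullary using (¬_; Dec; yes; no; ¬?)
open import Relation.Nullary.Decidable using (isYes; toWitness; fromWitness; decidable-stable; map′; _×-dec_)
open import Relation.Unary using (Decidable)

open Equivalence using (to; from)
open ≡-Reasoning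

∈-tabulate : ∀ {n} {f : Fin n → Bool} {x} → x ∈ tabulate f ⇔ f x ≡ inside
∈-tabulate {f = f} {x} = mk⇔
  (λ x∈ → trans (sym (lookup∘tabulate f x)) ([]=⇒lookup x∈))
  (λ fx≡ → lookup⇒[]= x _ (trans (lookup∘tabulate f x) fx≡))

module _ {n : ℕ} (π : Perm n) where

  $-injective : Injective _≡_ _≡_ (π $_)
  $-injective e = trans (sym (inverseˡ π)) (trans (cong (π ⟨$⟩ˡ_) e) (inverseˡ π))

  iter-+ : ∀ m k x → iter π (m + k) x ≡ iter π m (iter π k x)
  iter-+ zero    k x = refl
  iter-+ (suc m) k x = cong (π $_) (iter-+ m k x)

  iter-cong : ∀ {m k} x → m ≡ k → iter π m x ≡ iter π k x
  iter-cong x = cong (λ t → iter π t x)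

  iter-injective : ∀ m → Injective _≡_ _≡_ (iter π m)
  iter-injective zero    e = e
  iter-injective (suc m) e = iter-injective m ($-injective e)

  iter-period : ∀ x → ∃ λ p → p < n × iter π (suc p) x ≡ x
  iter-period x with Finₚ.pigeonhole (ℕ.n<1+n n) (λ i → iter π (toℕ i) x)
  ... | i , j , i<j , πⁱx≡πʲx = d , d<n , sym (iter-injective (toℕ i) (begin
      iter π (toℕ i) x                   ≡⟨ πⁱx≡πʲx ⟩
      iter π (toℕ j) x                   ≡⟨ iter-cong x i+[1+d]≡j ⟨
      iter π (toℕ i + suc d) x           ≡⟨ iter-+ (toℕ i) (suc d) x ⟩
      iter π (toℕ i) (iter π (suc d) x)  ∎))
    where
    d : ℕ
    d = toℕ j ∸ suc (toℕ i)
    i+[1+d]≡j : toℕ i + suc d ≡ toℕ j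
    i+[1+d]≡j = trans (ℕ.+-suc (toℕ i) d) (ℕ.m+[n∸m]≡n i<j)
    d<n : d < n
    d<n = ℕ.≤-trans (ℕ.m≤n+m (suc d) (toℕ i))
                    (ℕ.≤-trans (ℕ.≤-reflexive i+[1+d]≡j) (s≤s⁻¹ (Finₚ.toℕ<n j)))

  iter-*-period : ∀ {p x} → iter π (suc p) x ≡ x → ∀ k → iter π (k * suc p) x ≡ x
  iter-*-period         πᵖ⁺¹x≡x zero    = refl
  iter-*-period {p} {x} πᵖ⁺¹x≡x (suc k) = begin
    iter π (suc p + k * suc p) x           ≡⟨ iter-+ (suc p) (k * suc p) x ⟩
    iter π (suc p) (iter π (k * suc p) x)  ≡⟨ cong (iter π (suc p)) (iter-*-period πᵖ⁺¹x≡x k) ⟩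
    iter π (suc p) x                       ≡⟨ πᵖ⁺¹x≡x ⟩
    x                                      ∎

  sameCycle-refl : ∀ x → SameCycle π x x
  sameCycle-refl x = 0 , refl

  sameCycle-step : ∀ x → SameCycle π x (π $ x)
  sameCycle-step x = 1 , refl

  sameCycle-trans : ∀ {x y z} → SameCycle π x y → SameCycle π y z → SameCycle π x z
  sameCycle-trans {x} (m , πᵐx≡y) (k , πᵏy≡z) =
    k + m , trans (iter-+ k m x) (trans (cong (iter π k) πᵐx≡y) πᵏy≡z)

  sameCycle-sym : ∀ {x y} → SameCycle π x y → SameCycle π y x
  sameCycle-sym {x} {y} (m , πᵐx≡y) = m * p , (begin
    iter π (m * p) y             ≡⟨ cong (iter π (m * p)) πᵐx≡y ⟨
    iter π (m * p) (iter π m x)  ≡⟨ iter-+ (m * p) m x ⟨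
    iter π (m * p + m) x         ≡⟨ iter-cong x (trans (ℕ.+-comm (m * p) m) (sym (ℕ.*-suc m p))) ⟩
    iter π (m * suc p) x         ≡⟨ iter-*-period (proj₂ (proj₂ (iter-period x))) m ⟩
    x                            ∎)
    where
    p : ℕ
    p = proj₁ (iter-period x)

  sameCycle-bounded : ∀ {x y} → SameCycle π x y → ∃ λ (m : Fin n) → iter π (toℕ m) x ≡ y
  sameCycle-bounded {x} {y} (m , πᵐx≡y) = fromℕ< r<n , (begin
    iter π (toℕ (fromℕ< r<n)) x                         ≡⟨ iter-cong x (Finₚ.toℕ-fromℕ< r<n) ⟩
    iter π (m % suc p) x
      ≡⟨ cong (iter π (m % suc p)) (iter-*-period πᵖ⁺¹x≡x (m / suc p)) ⟨
    iter π (m % suc p) (iter π (m / suc p * suc p) x)   ≡⟨ iter-+ (m % suc p) _ x ⟨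
    iter π (m % suc p + m / suc p * suc p) x            ≡⟨ iter-cong x (m≡m%n+[m/n]*n m (suc p)) ⟨
    iter π m x                                          ≡⟨ πᵐx≡y ⟩
    y                                                   ∎)
    where
    p : ℕ
    p = proj₁ (iter-period x)
    πᵖ⁺¹x≡x : iter π (suc p) x ≡ x
    πᵖ⁺¹x≡x = proj₂ (proj₂ (iter-period x))
    r<n : m % suc p < n
    r<n = ℕ.≤-trans (m%n<n m (suc p)) (proj₁ (proj₂ (iter-period x)))

  sameCycle? : ∀ x y → Dec (SameCycle π x y)
  sameCycle? x y = map′ (λ (m , e) → toℕ m , e) sameCycle-bounded
                        (Finₚ.any? (λ m → iter π (toℕ m) x Finₚ.≟ y))

  module _ {C : Subset n} (C-cycle : IsCycle π C) where

    ∈-cycle-sameCycle : ∀ {y z} → y ∈ C → z ∈ C → SameCycle π y z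
    ∈-cycle-sameCycle y∈C z∈C =
      sameCycle-trans (sameCycle-sym (to (proj₂ C-cycle _) y∈C)) (to (proj₂ C-cycle _) z∈C)

    ∈-cycle-closed : ∀ {y z} → y ∈ C → SameCycle π y z → z ∈ C
    ∈-cycle-closed y∈C y~z = from (proj₂ C-cycle _) (sameCycle-trans (to (proj₂ C-cycle _) y∈C) y~z)

    ∈-cycle-$⁺ : ∀ {y} → y ∈ C → π $ y ∈ C
    ∈-cycle-$⁺ y∈C = ∈-cycle-closed y∈C (sameCycle-step _)

    ∈-cycle-$⁻ : ∀ {y} → π $ y ∈ C → y ∈ C
    ∈-cycle-$⁻ πy∈C = ∈-cycle-closed πy∈C (sameCycle-sym (sameCycle-step _))

    ∈-cycle-iter : ∀ {y} m → y ∈ C → iter π m y ∈ C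
    ∈-cycle-iter m y∈C = ∈-cycle-closed y∈C (m , refl)

  cycle-≡ : ∀ {C D y} → IsCycle π C → IsCycle π D → y ∈ C → y ∈ D → C ≡ D
  cycle-≡ C-cycle D-cycle y∈C y∈D = ⊆-antisym
    (λ z∈C → ∈-cycle-closed D-cycle y∈D (∈-cycle-sameCycle C-cycle y∈C z∈C))
    (λ z∈D → ∈-cycle-closed C-cycle y∈C (∈-cycle-sameCycle D-cycle y∈D z∈D))

  orbit : Fin n → Subset n
  orbit x = tabulate (isYes ∘ sameCycle? x)

  orbit-isCycle : ∀ x → IsCycle π (orbit x)
  orbit-isCycle x = x , λ y → mk⇔
    (λ y∈ → toWitness {a? = sameCycle? x y} (from T-≡ (to ∈-tabulate y∈)))
    (λ x~y → from ∈-tabulate (to T-≡ (fromWitness {a? = sameCycle? x y} x~y)))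

  ∈-orbit : ∀ x → x ∈ orbit x
  ∈-orbit x = from (proj₂ (orbit-isCycle x) x) (sameCycle-refl x)

indicator : Bool → ℕ
indicator true  = 1
indicator false = 0

∣p∣≡sum : ∀ {n} (p : Subset n) → ∣ p ∣ ≡ sum (indicator ∘ lookup p)
∣p∣≡sum []          = refl
∣p∣≡sum (true  ∷ p) = cong suc (∣p∣≡sum p)
∣p∣≡sum (false ∷ p) = ∣p∣≡sum p

preimage : ∀ {n} → Perm n → Subset n → Subset n
preimage φ C = tabulate (lookup C ∘ (φ $_))

module _ {n : ℕ} (φ : Perm n) where

  ∈-preimage : ∀ {C b} → b ∈ preimage φ C ⇔ φ $ b ∈ C
  ∈-preimage {C} = mk⇔ (lookup⇒[]= _ C ∘ to ∈-tabulate) (from ∈-tabulate ∘ []=⇒lookup)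

  ∣preimage∣ : ∀ C → ∣ preimage φ C ∣ ≡ ∣ C ∣
  ∣preimage∣ C = begin
    ∣ preimage φ C ∣                          ≡⟨ ∣p∣≡sum (preimage φ C) ⟩
    sum (indicator ∘ lookup (preimage φ C))
      ≡⟨ sum-cong-≗ (cong indicator ∘ lookup∘tabulate (lookup C ∘ (φ $_))) ⟩
    sum (indicator ∘ lookup C ∘ (φ $_))       ≡⟨ sum-permute (indicator ∘ lookup C) φ ⟨
    sum (indicator ∘ lookup C)                ≡⟨ ∣p∣≡sum C ⟨
    ∣ C ∣                                     ∎

  preimage-reflects-⊆ : ∀ {C D} → preimage φ C ⊆ preimage φ D → C ⊆ D
  preimage-reflects-⊆ {C} {D} C⊆D y∈C = subst (_∈ D) (inverseʳ φ)
    (to ∈-preimage (C⊆D (from ∈-preimage (subst (_∈ C) (sym (inverseʳ φ)) y∈C))))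

  preimage-injective : Injective _≡_ _≡_ (preimage φ)
  preimage-injective e =
    ⊆-antisym (preimage-reflects-⊆ (⊆-reflexive e)) (preimage-reflects-⊆ (⊆-reflexive (sym e)))

  module _ (β : Perm n) (φ-β : ∀ x → φ $ (β $ x) ≡ β $ (φ $ x)) where

    iter-φ : ∀ m x → φ $ iter β m x ≡ iter β m (φ $ x)
    iter-φ zero    x = refl
    iter-φ (suc m) x = trans (φ-β (iter β m x)) (cong (β $_) (iter-φ m x))

    sameCycle-φ : ∀ {a b} → SameCycle β (φ ⟨$⟩ˡ a) b ⇔ SameCycle β a (φ $ b)
    sameCycle-φ {a} {b} = mk⇔
      (λ (m , e) → m , trans (cong (iter β m) (sym (inverseʳ φ))) (trans (sym (iter-φ m _)) (cong (φ $_) e)))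
      (λ (m , e) → m , $-injective φ (trans (iter-φ m _) (trans (cong (iter β m) (inverseʳ φ)) e)))

    preimage-isCycle : ∀ {C} → IsCycle β C → IsCycle β (preimage φ C)
    preimage-isCycle (a , C≡orbit) =
      φ ⟨$⟩ˡ a , λ b → ⇔.trans ∈-preimage (⇔.trans (C≡orbit (φ $ b)) (⇔.sym sameCycle-φ))

injective⇒surjective : ∀ {n} (f : Fin n → Fin n) → Injective _≡_ _≡_ f → ∀ y → ∃ λ x → f x ≡ y
injective⇒surjective {zero}  f f-injective ()
injective⇒surjective {suc m} f f-injective y with Finₚ.any? (λ x → f x Finₚ.≟ y)
... | yes hit = hit
... | no ¬hit = ⊥-elim (ℕ.1+n≰n (Finₚ.injective⇒≤ g-injective))
  where
  y≢f : ∀ x → y ≢ f x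
  y≢f x y≡fx = ¬hit (x , sym y≡fx)
  g : Fin (suc m) → Fin m
  g x = punchOut (y≢f x)
  g-injective : Injective _≡_ _≡_ g
  g-injective e = f-injective (Finₚ.punchOut-injective (y≢f _) (y≢f _) e)

fromInjective : ∀ {n} (f : Fin n → Fin n) → Injective _≡_ _≡_ f → Perm n
fromInjective f f-injective =
  permutation f (proj₁ ∘ surjective) (proj₂ ∘ surjective) (λ x → f-injective (proj₂ (surjective (f x))))
  where
  surjective : ∀ y → ∃ λ x → f x ≡ y
  surjective = injective⇒surjective f f-injective

module FirstReturn {n : ℕ} (α β : Perm n) {U : Fin n → Set} (U? : Decidable U)
  (U-β⁺ : ∀ {x} → U x → U (β $ x)) (U-β⁻ : ∀ {x} → U (β $ x) → U x)
  (commute-off-U : ∀ x → ¬ U x → α $ (β $ x) ≡ β $ (α $ x)) where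

  α⁻¹ : Fin n → Fin n
  α⁻¹ = α ⟨$⟩ˡ_

  step : Fin n → Fin n
  step x with U? x
  ... | yes _ = x
  ... | no  _ = α $ x

  step-∈ : ∀ {x} → U x → step x ≡ x
  step-∈ {x} x∈U with U? x
  ... | yes _   = refl
  ... | no  x∉U = ⊥-elim (x∉U x∈U)

  step-∉ : ∀ {x} → ¬ U x → step x ≡ α $ x
  step-∉ {x} x∉U with U? x
  ... | yes x∈U = ⊥-elim (x∉U x∈U)
  ... | no  _   = refl

  step-β : ∀ x → step (β $ x) ≡ β $ (step x)
  step-β x with U? x
  ... | yes x∈U = step-∈ (U-β⁺ x∈U)
  ... | no  x∉U = trans (step-∉ (x∉U ∘ U-β⁻)) (commute-off-U x x∉U)

  steps : ℕ → Fin n → Fin n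
  steps zero    x = x
  steps (suc k) x = step (steps k x)

  steps-β : ∀ k x → steps k (β $ x) ≡ β $ (steps k x)
  steps-β zero    x = refl
  steps-β (suc k) x = trans (cong step (steps-β k x)) (step-β (steps k x))

  Avoids : ℕ → Fin n → Set
  Avoids t b = ∀ j → j < t → ¬ U (iter α j b)

  -- time is the first hitting time of U along the α-orbit of b, capped at k.
  record StoppingTime (k : ℕ) (b : Fin n) : Set where
    field
      time    : ℕ
      time≤k  : time ≤ k
      steps≡  : steps k b ≡ iter α time b
      avoids  : Avoids time b
      arrived : time < k → U (iter α time b)

  stoppingTime : ∀ k b → StoppingTime k b
  stoppingTime zero b = record
    { time = 0 ; time≤k = z≤n ; steps≡ = refl ; avoids = λ _ () ; arrived = λ () }
  stoppingTime (suc k) b with stoppingTime k b | U? (steps k b)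
  ... | s | yes stopped = record
    { time    = time
    ; time≤k  = ℕ.m≤n⇒m≤1+n time≤k
    ; steps≡  = trans (step-∈ stopped) steps≡
    ; avoids  = avoids
    ; arrived = λ _ → subst U steps≡ stopped
    }
    where open StoppingTime s
  ... | s | no moving = record
    { time    = suc time
    ; time≤k  = s≤s time≤k
    ; steps≡  = trans (step-∉ moving) (cong (α $_) steps≡)
    ; avoids  = avoids′
    ; arrived = λ t<k → ⊥-elim (moving (subst U (sym steps≡) (arrived (s≤s⁻¹ t<k))))
    }
    where
    open StoppingTime s
    avoids′ : Avoids (suc time) b
    avoids′ j j<1+t with ℕ.m≤n⇒m<n∨m≡n (s≤s⁻¹ j<1+t)
    ... | inj₁ j<t  = avoids j j<t
    ... | inj₂ refl = moving ∘ subst U (sym steps≡)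

  InImage : Fin n → Set
  InImage b = U (α⁻¹ b)

  InImage⇒¬Avoids : ∀ {b} → InImage b → ¬ Avoids n b
  InImage⇒¬Avoids {b} α⁻¹b∈U avoids = avoids p p<n (subst U (sym αᵖb≡α⁻¹b) α⁻¹b∈U)
    where
    p : ℕ
    p = proj₁ (iter-period α b)
    p<n : p < n
    p<n = proj₁ (proj₂ (iter-period α b))
    αᵖb≡α⁻¹b : iter α p b ≡ α⁻¹ b
    αᵖb≡α⁻¹b = trans (sym (inverseˡ α)) (cong α⁻¹ (proj₂ (proj₂ (iter-period α b))))

  steps-InImage : ∀ {b} → InImage b → U (steps n b)
  steps-InImage {b} α⁻¹b∈U with ℕ.m≤n⇒m<n∨m≡n (StoppingTime.time≤k (stoppingTime n b))
  ... | inj₁ t<n = subst U (sym steps≡) (arrived t<n)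
    where open StoppingTime (stoppingTime n b)
  ... | inj₂ t≡n = ⊥-elim (InImage⇒¬Avoids α⁻¹b∈U (subst (λ t → Avoids t b) t≡n avoids))
    where open StoppingTime (stoppingTime n b)

  -- Were the orbit of b′ to reach b after d > 0 steps, it would pass α⁻¹ b ∈ U first.
  first-hit-injective : ∀ {b b′} t d → InImage b → Avoids (t + d) b′ →
                        iter α t b ≡ iter α (t + d) b′ → b ≡ b′
  first-hit-injective {b} {b′} t zero    _       _      αᵗb≡αᵗb′ =
    iter-injective α t (trans αᵗb≡αᵗb′ (iter-cong α b′ (ℕ.+-identityʳ t)))
  first-hit-injective {b} {b′} t (suc e) α⁻¹b∈U avoids αᵗb≡αᵗ⁺ᵈb′ =
    ⊥-elim (avoids e (ℕ.m≤n+m (suc e) t) (subst U α⁻¹b≡αᵉb′ α⁻¹b∈U))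
    where
    α⁻¹b≡αᵉb′ : α⁻¹ b ≡ iter α e b′
    α⁻¹b≡αᵉb′ = trans (cong α⁻¹ (iter-injective α t (trans αᵗb≡αᵗ⁺ᵈb′ (iter-+ α t (suc e) b′))))
                      (inverseˡ α)

  first-hits-injective : ∀ {b b′ t t′} → InImage b → InImage b′ → Avoids t b → Avoids t′ b′ →
                         iter α t b ≡ iter α t′ b′ → b ≡ b′
  first-hits-injective {t = t} {t′} α⁻¹b∈U α⁻¹b′∈U avoids avoids′ e with ℕ.≤-total t t′
  ... | inj₁ t≤t′ with d , refl ← ℕ.m≤n⇒∃[o]m+o≡n t≤t′ =
    first-hit-injective t d α⁻¹b∈U avoids′ e
  ... | inj₂ t′≤t with d , refl ← ℕ.m≤n⇒∃[o]m+o≡n t′≤t =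
    sym (first-hit-injective t′ d α⁻¹b′∈U avoids (sym e))

  steps-injective : ∀ {b b′} → InImage b → InImage b′ → steps n b ≡ steps n b′ → b ≡ b′
  steps-injective {b} {b′} α⁻¹b∈U α⁻¹b′∈U e =
    first-hits-injective α⁻¹b∈U α⁻¹b′∈U (avoids s) (avoids s′)
    (trans (sym (steps≡ s)) (trans e (steps≡ s′)))
    where
    open StoppingTime
    s : StoppingTime n b
    s = stoppingTime n b
    s′ : StoppingTime n b′
    s′ = stoppingTime n b′

  α⁻¹β-off-U : ∀ {x} → ¬ U x → α⁻¹ (β $ (α $ x)) ≡ β $ x
  α⁻¹β-off-U {x} x∉U = begin
    α⁻¹ (β $ (α $ x))  ≡⟨ cong α⁻¹ (commute-off-U x x∉U) ⟨
    α⁻¹ (α $ (β $ x))  ≡⟨ inverseˡ α ⟩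
    β $ x              ∎

  α⁻¹-β : ∀ {b} → ¬ InImage b → α⁻¹ (β $ b) ≡ β $ (α⁻¹ b)
  α⁻¹-β {b} α⁻¹b∉U = trans (cong (α⁻¹ ∘ (β $_)) (sym (inverseʳ α))) (α⁻¹β-off-U α⁻¹b∉U)

  ¬InImage-β⁺ : ∀ {b} → ¬ InImage b → ¬ InImage (β $ b)
  ¬InImage-β⁺ α⁻¹b∉U = α⁻¹b∉U ∘ U-β⁻ ∘ subst U (α⁻¹-β α⁻¹b∉U)

  ¬InImage-β⁻ : ∀ {b} → ¬ InImage (β $ b) → ¬ InImage b
  ¬InImage-β⁻ {b} y∉U = x∉U ∘ subst U α⁻¹b≡x
    where
    y x : Fin n
    y = α⁻¹ (β $ b)
    x = β ⟨$⟩ˡ y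
    x∉U : ¬ U x
    x∉U = y∉U ∘ subst U (inverseʳ β) ∘ U-β⁺
    αx≡b : α $ x ≡ b
    αx≡b = $-injective β ($-injective (flip α) (begin
      α⁻¹ (β $ (α $ x))  ≡⟨ α⁻¹β-off-U x∉U ⟩
      β $ x              ≡⟨ inverseʳ β ⟩
      α⁻¹ (β $ b)        ∎))
    α⁻¹b≡x : α⁻¹ b ≡ x
    α⁻¹b≡x = trans (cong α⁻¹ (sym αx≡b)) (inverseˡ α)

  InImage-β : ∀ {b} → InImage b → InImage (β $ b)
  InImage-β α⁻¹b∈U = decidable-stable (U? _) (λ α⁻¹βb∉U → ¬InImage-β⁻ α⁻¹βb∉U α⁻¹b∈U)

  φ₀ : Fin n → Fin n
  φ₀ b with U? (α⁻¹ b)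
  ... | yes _ = steps n b
  ... | no  _ = α⁻¹ b

  φ₀-∈ : ∀ {b} → InImage b → φ₀ b ≡ steps n b
  φ₀-∈ {b} α⁻¹b∈U with U? (α⁻¹ b)
  ... | yes _       = refl
  ... | no  α⁻¹b∉U  = ⊥-elim (α⁻¹b∉U α⁻¹b∈U)

  φ₀-∉ : ∀ {b} → ¬ InImage b → φ₀ b ≡ α⁻¹ b
  φ₀-∉ {b} α⁻¹b∉U with U? (α⁻¹ b)
  ... | yes α⁻¹b∈U = ⊥-elim (α⁻¹b∉U α⁻¹b∈U)
  ... | no  _      = refl

  U-φ₀ : ∀ b → U (φ₀ b) ⇔ InImage b
  U-φ₀ b with U? (α⁻¹ b)
  ... | yes α⁻¹b∈U = mk⇔ (λ _ → α⁻¹b∈U) (λ _ → steps-InImage α⁻¹b∈U)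
  ... | no  _      = ⇔.refl

  φ₀-injective : Injective _≡_ _≡_ φ₀
  φ₀-injective {b} {b′} e with U? (α⁻¹ b) | U? (α⁻¹ b′)
  ... | yes α⁻¹b∈U | yes α⁻¹b′∈U = steps-injective α⁻¹b∈U α⁻¹b′∈U e
  ... | no  _      | no  _       = $-injective (flip α) e
  ... | yes α⁻¹b∈U | no  α⁻¹b′∉U = ⊥-elim (α⁻¹b′∉U (subst U e (steps-InImage α⁻¹b∈U)))
  ... | no  α⁻¹b∉U | yes α⁻¹b′∈U = ⊥-elim (α⁻¹b∉U (subst U (sym e) (steps-InImage α⁻¹b′∈U)))

  φ₀-β : ∀ b → φ₀ (β $ b) ≡ β $ (φ₀ b)
  φ₀-β b with U? (α⁻¹ b)
  ... | yes α⁻¹b∈U = trans (φ₀-∈ (InImage-β α⁻¹b∈U)) (steps-β n b)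
  ... | no  α⁻¹b∉U = trans (φ₀-∉ (¬InImage-β⁺ α⁻¹b∉U)) (α⁻¹-β α⁻¹b∉U)

  φ : Perm n
  φ = fromInjective φ₀ φ₀-injective

  φ-β : ∀ b → φ $ (β $ b) ≡ β $ (φ $ b)
  φ-β = φ₀-β

  U-φ : ∀ b → U (φ $ b) ⇔ U (α⁻¹ b)
  U-φ = U-φ₀

module _ {n : ℕ} (α β : Perm n) where

  ¬Bad⇒commute : ∀ {a} → ¬ Bad α β a → (α · β) a ≡ (β · α) a
  ¬Bad⇒commute {a} = decidable-stable ((α · β) a Finₚ.≟ (β · α) a)

  ¬CommutesOn⇒Bad : ∀ {C} → ¬ CommutesOn α β C → ∃ λ a → a ∈ C × Bad α β a
  ¬CommutesOn⇒Bad {C} ¬commutes = decidable-stable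
    (Finₚ.any? (λ a → (a ∈? C) ×-dec ¬? ((α · β) a Finₚ.≟ (β · α) a)))
    (λ no-bad → ¬commutes (λ a a∈C bad → no-bad (a , a∈C , bad)))

  module _ {D : Subset n} (D-cycle : IsCycle β D) {c : Fin n} (αc∈D : α $ c ∈ D) where

    bad-image-of-orbit : ∀ m → Bad α β (iter β m c) → α $ iter β m c ≡ iter β m (α $ c) →
                         ∃ λ x → Bad α β x × α $ x ∈ D
    bad-image-of-orbit m bad αβᵐc≡βᵐαc =
      iter β m c , bad , subst (_∈ D) (sym αβᵐc≡βᵐαc) (∈-cycle-iter β D-cycle m αc∈D)

    commute-along-orbit : ∀ m → (∃ λ x → Bad α β x × α $ x ∈ D) ⊎ α $ iter β m c ≡ iter β m (α $ c)
    commute-along-orbit zero = inj₂ refl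
    commute-along-orbit (suc m) with commute-along-orbit m
    ... | inj₁ found = inj₁ found
    ... | inj₂ αβᵐc≡βᵐαc with (α · β) (iter β m c) Finₚ.≟ (β · α) (iter β m c)
    ...   | yes commutes = inj₂ (trans commutes (cong (β $_) αβᵐc≡βᵐαc))
    ...   | no  bad      = inj₁ (bad-image-of-orbit m bad αβᵐc≡βᵐαc)

    bad-image-on-cycle : ∀ m → Bad α β (iter β m c) → ∃ λ x → Bad α β x × α $ x ∈ D
    bad-image-on-cycle m bad with commute-along-orbit m
    ... | inj₁ found     = found
    ... | inj₂ αβᵐc≡βᵐαc = bad-image-of-orbit m bad αβᵐc≡βᵐαc

module NonCommutingCycles {n r : ℕ} (α β : Perm n) (cyc : Fin r → Subset n)
  (cyc-isCycle : ∀ j → IsCycle β (cyc j))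
  (cyc-¬commutes : ∀ j → ¬ CommutesOn α β (cyc j))
  (cyc-complete : ∀ C → IsCycle β C → ¬ CommutesOn α β C → ∃ λ j → cyc j ≡ C) where

  U : Fin n → Set
  U = InUnion cyc

  U? : Decidable U
  U? a = Finₚ.any? (λ j → a ∈? cyc j)

  U-β⁺ : ∀ {x} → U x → U (β $ x)
  U-β⁺ (j , x∈) = j , ∈-cycle-$⁺ β (cyc-isCycle j) x∈

  U-β⁻ : ∀ {x} → U (β $ x) → U x
  U-β⁻ (j , βx∈) = j , ∈-cycle-$⁻ β (cyc-isCycle j) βx∈

  Bad⇒U : ∀ {a} → Bad α β a → U a
  Bad⇒U {a} bad
    with j , cycʲ≡orbit ← cyc-complete (orbit β a) (orbit-isCycle β a) (λ commutes → commutes a (∈-orbit β a) bad) =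
    j , subst (a ∈_) (sym cycʲ≡orbit) (∈-orbit β a)

  commute-off-U : ∀ x → ¬ U x → α $ (β $ x) ≡ β $ (α $ x)
  commute-off-U x x∉U = ¬Bad⇒commute α β (x∉U ∘ Bad⇒U)

  U⇒bad-on-orbit : ∀ {a} → U a → ∃ λ m → Bad α β (iter β m a)
  U⇒bad-on-orbit (j , a∈) with y , y∈ , bad ← ¬CommutesOn⇒Bad α β (cyc-¬commutes j)
                           with m , βᵐa≡y ← ∈-cycle-sameCycle β (cyc-isCycle j) a∈ y∈ =
    m , subst (Bad α β) (sym βᵐa≡y) bad

  open FirstReturn α β U? U-β⁺ U-β⁻ commute-off-U public using (φ; φ-β; U-φ)

  cyc′ : Fin r → Subset n
  cyc′ = preimage φ ∘ cyc

  image-union : ∀ b → (∃ λ a → U a × α $ a ≡ b) ⇔ InUnion cyc′ b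
  image-union b = mk⇔
    (λ (a , a∈U , αa≡b) →
      let (j , φb∈) = from (U-φ b) (subst U (trans (sym (inverseˡ α)) (cong (α ⟨$⟩ˡ_) αa≡b)) a∈U)
      in j , from (∈-preimage φ) φb∈)
    (λ (j , b∈) → α ⟨$⟩ˡ b , to (U-φ b) (j , to (∈-preimage φ) b∈) , inverseʳ α)

  cycle-meeting-αU-has-bad-image : ∀ {D b} → IsCycle β D → b ∈ D → U (α ⟨$⟩ˡ b) →
                                   ∃ λ x → Bad α β x × α $ x ∈ D
  cycle-meeting-αU-has-bad-image {D} D-cycle b∈D α⁻¹b∈U with m , bad ← U⇒bad-on-orbit α⁻¹b∈U =
    bad-image-on-cycle α β D-cycle (subst (_∈ D) (sym (inverseʳ α)) b∈D) m bad

  preimage-has-bad-image : ∀ {C} → IsCycle β C → ¬ CommutesOn α β C →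
                           ∃ λ a → Bad α β a × α $ a ∈ preimage φ C
  preimage-has-bad-image {C} C-cycle ¬commutes with y , y∈C , bad ← ¬CommutesOn⇒Bad α β ¬commutes =
    cycle-meeting-αU-has-bad-image (preimage-isCycle φ β φ-β C-cycle)
      (from (∈-preimage φ) (subst (_∈ C) (sym (inverseʳ φ)) y∈C))
      (to (U-φ _) (subst U (sym (inverseʳ φ)) (Bad⇒U bad)))

  bad-image-cycle : ∀ {D a} → IsCycle β D → Bad α β a → α $ a ∈ D → ∃ λ j → cyc′ j ≡ D
  bad-image-cycle {D} {a} D-cycle bad αa∈D
    with j , φαa∈ ← from (U-φ (α $ a)) (subst U (sym (inverseˡ α)) (Bad⇒U bad)) =
    j , cycle-≡ β (preimage-isCycle φ β φ-β (cyc-isCycle j)) D-cycle (from (∈-preimage φ) φαa∈) αa∈D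

  bad-image-cycles : ∀ i h →
    NumCycles β (λ C → ∣ C ∣ ≡ i × ¬ CommutesOn α β C) h →
    NumCycles β (λ C → ∣ C ∣ ≡ i × ∃ λ a → Bad α β a × α $ a ∈ C) h
  bad-image-cycles i h (L , L-injective , L-cycles , L-complete) =
    preimage φ ∘ L , (λ e → L-injective (preimage-injective φ e)) , cycles , complete
    where
    cycles : ∀ j → IsCycle β (preimage φ (L j)) × ∣ preimage φ (L j) ∣ ≡ i ×
                   ∃ λ a → Bad α β a × α $ a ∈ preimage φ (L j)
    cycles j = preimage-isCycle φ β φ-β L-cycle , trans (∣preimage∣ φ (L j)) ∣L∣≡i ,
               preimage-has-bad-image L-cycle ¬commutes
      where
      L-cycle : IsCycle β (L j)
      L-cycle = proj₁ (L-cycles j)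
      ∣L∣≡i : ∣ L j ∣ ≡ i
      ∣L∣≡i = proj₁ (proj₂ (L-cycles j))
      ¬commutes : ¬ CommutesOn α β (L j)
      ¬commutes = proj₂ (proj₂ (L-cycles j))
    complete : ∀ D → IsCycle β D → ∣ D ∣ ≡ i × (∃ λ a → Bad α β a × α $ a ∈ D) →
               ∃ λ k → preimage φ (L k) ≡ D
    complete D D-cycle (∣D∣≡i , a , bad , αa∈D) = k , trans (cong (preimage φ) Lᵏ≡cycʲ) cyc′ʲ≡D
      where
      j : Fin r
      j = proj₁ (bad-image-cycle D-cycle bad αa∈D)
      cyc′ʲ≡D : cyc′ j ≡ D
      cyc′ʲ≡D = proj₂ (bad-image-cycle D-cycle bad αa∈D)
      ∣cycʲ∣≡i : ∣ cyc j ∣ ≡ i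
      ∣cycʲ∣≡i = trans (sym (∣preimage∣ φ (cyc j))) (trans (cong ∣_∣ cyc′ʲ≡D) ∣D∣≡i)
      k : Fin h
      k = proj₁ (L-complete (cyc j) (cyc-isCycle j) (∣cycʲ∣≡i , cyc-¬commutes j))
      Lᵏ≡cycʲ : L k ≡ cyc j
      Lᵏ≡cycʲ = proj₂ (L-complete (cyc j) (cyc-isCycle j) (∣cycʲ∣≡i , cyc-¬commutes j))

-- The hypothesis k > 0 only rules out r = 0, where everything is trivial.
proposition5 : (n : ℕ) (α β : Perm n) (k : ℕ) →
    H (α · β) (β · α) ≡ k → 0 < k →
    (r : ℕ) (cyc : Fin r → Subset n) →
    (∀ j → IsCycle β (cyc j)) →
    Injective _≡_ _≡_ cyc →
    (∀ j → ¬ CommutesOn α β (cyc j)) →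
    (∀ C → IsCycle β C → ¬ CommutesOn α β C → ∃ λ j → cyc j ≡ C) →
    (Σ (Fin r → Subset n) λ cyc′ →
        (∀ j → IsCycle β (cyc′ j))
        × Injective _≡_ _≡_ cyc′
        × (∀ j → ∣ cyc′ j ∣ ≡ ∣ cyc j ∣)
        × (∀ b → (∃ λ a → InUnion cyc a × α $ a ≡ b) ⇔ InUnion cyc′ b))
    × ((i h : ℕ) →
        NumCycles β (λ C → ∣ C ∣ ≡ i × ¬ CommutesOn α β C) h →
        NumCycles β (λ C → ∣ C ∣ ≡ i × ∃ λ a → Bad α β a × α $ a ∈ C) h)
proposition5 n α β k _ _ r cyc cyc-isCycle cyc-injective cyc-¬commutes cyc-complete =
  ( cyc′
  , (λ j → preimage-isCycle φ β φ-β (cyc-isCycle j))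
  , (λ e → cyc-injective (preimage-injective φ e))
  , ∣preimage∣ φ ∘ cyc
  , image-union )
  , bad-image-cycles
  where open NonCommutingCycles α β cyc cyc-isCycle cyc-¬commutes cyc-complete
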